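{- Let $\mathcal{L}$ be a finite distributive lattice, let $\alpha$ be a maximal join-irreducible element of $\mathcal{L}$, let $\mathcal{L}_\alpha=\{\beta\in\mathcal{L}:\beta\not\geq\alpha\}$ and $X_\alpha=\mathcal{L}\setminus\mathcal{L}_\alpha$. For $\gamma\in X_\alpha$ let $C_\gamma=\{x\in\mathcal{L}_\alpha : x\vee\alpha=\gamma\}$ and let $x_\gamma$ be the greatest element of $C_\gamma$. For $\delta\in\mathcal{L}$ let $s(\delta)=|\{\beta\in\mathcal{L}:\beta\leq\delta\}|$ and $s_\alpha(\delta)=|\{\beta\in\mathcal{L}:\beta\leq\delta\}\cap\mathcal{L}_\alpha|$. Then for every $\delta\in X_\alpha$, \[s_\alpha(\delta)=s_\alpha(x_\delta)=s(x_\delta).\]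
   Context: A maximal join-irreducible element of $\mathcal{L}$ is a join-irreducible element that is maximal among the join-irreducible elements of $\mathcal{L}$. For each $\gamma\in X_\alpha$ the set $C_\gamma$ is a non-empty sublattice of $\mathcal{L}$, so it has a greatest element $x_\gamma$. -}

module Defs where

open import Level using (_⊔_)
open import Data.Nat using (ℕ)
open import Data.Fin using (Fin)
open import Data.List using (length; filter; allFin)
open import Data.Product using (_×_; ∃)
open import Data.Sum using (_⊎_)
open import Relation.Nullary using (¬_)
open import Relation.Nullary.Decidable using (_×-dec_; ¬?)
open import Relation.Binary using (Rel; Decidable)
open import Relation.Binary.PropositionalEquality using (_≡_)
open import Algebra.Lattice.Bundles using (DistributiveLattice)

-- Finiteness of a (setoid-based) distributive lattice: an enumeration
-- Fin size → Carrier which is a bijection up to the lattice equality _≈_,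
-- together with decidability of _≈_ (needed to count elements).
record Finite {c ℓ} (L : DistributiveLattice c ℓ) : Set (c ⊔ ℓ) where
  open DistributiveLattice L
  field
    size : ℕ
    enum : Fin size → Carrier
    surj : ∀ x → ∃ λ i → enum i ≈ x
    inj  : ∀ i j → enum i ≈ enum j → i ≡ j
    _≈?_ : Decidable _≈_

module Order {c ℓ} (L : DistributiveLattice c ℓ) where
  open DistributiveLattice L

  _≤_ : Rel Carrier ℓ
  x ≤ y = x ∨ y ≈ y

  IsJoinIrreducible : Carrier → Set (c ⊔ ℓ)
  IsJoinIrreducible α =
    (¬ (∀ x → α ≤ x)) × (∀ x y → α ≈ x ∨ y → (α ≈ x) ⊎ (α ≈ y))

  IsMaximalJoinIrreducible : Carrier → Set (c ⊔ ℓ)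
  IsMaximalJoinIrreducible α =
    IsJoinIrreducible α × (∀ β → IsJoinIrreducible β → α ≤ β → β ≈ α)

  InLα : Carrier → Carrier → Set ℓ
  InLα α β = ¬ (α ≤ β)

  -- membership in X_α = L \ L_α (classically: α ≤ β)
  InXα : Carrier → Carrier → Set ℓ
  InXα α β = α ≤ β

  InC : Carrier → Carrier → Carrier → Set ℓ
  InC α γ x = InLα α x × (x ∨ α ≈ γ)

  IsGreatestOfC : Carrier → Carrier → Carrier → Set (c ⊔ ℓ)
  IsGreatestOfC α γ x = InC α γ x × (∀ y → InC α γ y → y ≤ x)

  module Count (F : Finite L) where
    open Finite F

    _≤?_ : Decidable _≤_
    x ≤? y = (x ∨ y) ≈? y

    s : Carrier → ℕ
    s δ = length (filter (λ i → enum i ≤? δ) (allFin size))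

    sα : Carrier → Carrier → ℕ
    sα α δ = length (filter (λ i → (enum i ≤? δ) ×-dec ¬? (α ≤? enum i)) (allFin size))

module Submission where

open import Defs
open import Data.Product using (_×_; _,_; proj₁)
open import Data.Sum using (_⊎_; [_,_]) renaming (map to ⊎-map)
open import Data.List using (length; allFin)
open import Data.List.Properties using (filter-≐)
open import Relation.Binary.PropositionalEquality using (_≡_; cong)
open import Algebra.Lattice.Bundles using (DistributiveLattice)
import Algebra.Lattice.Properties.Lattice as LatticeProperties
import Relation.Binary.Reasoning.Setoid as SetoidReasoning

-- A join-irreducible element of a distributive lattice is join-prime. Hence
-- if β ≤ δ and β ∉ L_α, then β ∨ x_δ still avoids α and (β ∨ x_δ) ∨ α = δ,
-- so β ∨ x_δ ∈ C_δ and β ≤ x_δ. The L_α-part of the downset of δ is thus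
-- the downset of x_δ, which lies entirely in L_α.

module _ {c ℓ} (L : DistributiveLattice c ℓ) where
  open DistributiveLattice L
  open Order L
  open LatticeProperties lattice using (∨-idem)
  open SetoidReasoning setoid

  ≤-trans : ∀ {x y z} → x ≤ y → y ≤ z → x ≤ z
  ≤-trans {x} {y} {z} x≤y y≤z = begin
    x ∨ z        ≈⟨ ∨-congˡ y≤z ⟨
    x ∨ (y ∨ z)  ≈⟨ ∨-assoc x y z ⟨
    (x ∨ y) ∨ z  ≈⟨ ∨-congʳ x≤y ⟩
    y ∨ z        ≈⟨ y≤z ⟩
    z            ∎

  x≤x∨y : ∀ x y → x ≤ (x ∨ y)
  x≤x∨y x y = begin
    x ∨ (x ∨ y)  ≈⟨ ∨-assoc x x y ⟨
    (x ∨ x) ∨ y  ≈⟨ ∨-congʳ (∨-idem x) ⟩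
    x ∨ y        ∎

  x∨y≤y⇒x≤y : ∀ {x y} → (x ∨ y) ≤ y → x ≤ y
  x∨y≤y⇒x≤y {x} {y} x∨y≤y = begin
    x ∨ y        ≈⟨ ∨-congˡ (∨-idem y) ⟨
    x ∨ (y ∨ y)  ≈⟨ ∨-assoc x y y ⟨
    (x ∨ y) ∨ y  ≈⟨ x∨y≤y ⟩
    y            ∎

  x≈x∧y⇒x≤y : ∀ {x y} → x ≈ x ∧ y → x ≤ y
  x≈x∧y⇒x≤y {x} {y} x≈x∧y = begin
    x ∨ y        ≈⟨ ∨-congʳ x≈x∧y ⟩
    (x ∧ y) ∨ y  ≈⟨ ∨-comm (x ∧ y) y ⟩
    y ∨ (x ∧ y)  ≈⟨ ∨-congˡ (∧-comm x y) ⟩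
    y ∨ (y ∧ x)  ≈⟨ ∨-absorbs-∧ y x ⟩
    y            ∎

  joinIrreducible⇒joinPrime : ∀ {α} → IsJoinIrreducible α →
                              ∀ a b → α ≤ (a ∨ b) → α ≤ a ⊎ α ≤ b
  joinIrreducible⇒joinPrime {α} (_ , irreducible) a b α≤a∨b =
    ⊎-map x≈x∧y⇒x≤y x≈x∧y⇒x≤y (irreducible (α ∧ a) (α ∧ b) α≈α∧a∨α∧b)
    where
    α≈α∧a∨α∧b : α ≈ (α ∧ a) ∨ (α ∧ b)
    α≈α∧a∨α∧b = begin
      α                  ≈⟨ ∧-absorbs-∨ α (a ∨ b) ⟨
      α ∧ (α ∨ (a ∨ b))  ≈⟨ ∧-congˡ α≤a∨b ⟩
      α ∧ (a ∨ b)        ≈⟨ ∧-distribˡ-∨ α a b ⟩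
      (α ∧ a) ∨ (α ∧ b)  ∎

  InLα-downward : ∀ {α β x} → InLα α x → β ≤ x → InLα α β
  InLα-downward α≰x β≤x α≤β = α≰x (≤-trans α≤β β≤x)

  InC⇒≤ : ∀ {α γ x} → InC α γ x → x ≤ γ
  InC⇒≤ {α} {γ} {x} (_ , x∨α≈γ) = begin
    x ∨ γ        ≈⟨ ∨-congˡ x∨α≈γ ⟨
    x ∨ (x ∨ α)  ≈⟨ x≤x∨y x α ⟩
    x ∨ α        ≈⟨ x∨α≈γ ⟩
    γ            ∎

  ≤-greatestOfC : ∀ {α γ x} → IsJoinIrreducible α → IsGreatestOfC α γ x →
                  ∀ {β} → β ≤ γ → InLα α β → β ≤ x
  ≤-greatestOfC {α} {γ} {x} α-irr ((α≰x , x∨α≈γ) , greatest) {β} β≤γ α≰β =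
    x∨y≤y⇒x≤y (greatest (β ∨ x) (α≰β∨x , β∨x∨α≈γ))
    where
    α≰β∨x : InLα α (β ∨ x)
    α≰β∨x α≤β∨x = [ α≰β , α≰x ] (joinIrreducible⇒joinPrime α-irr β x α≤β∨x)

    β∨x∨α≈γ : (β ∨ x) ∨ α ≈ γ
    β∨x∨α≈γ = begin
      (β ∨ x) ∨ α  ≈⟨ ∨-assoc β x α ⟩
      β ∨ (x ∨ α)  ≈⟨ ∨-congˡ x∨α≈γ ⟩
      β ∨ γ        ≈⟨ β≤γ ⟩
      γ            ∎

module _ {c ℓ} {L : DistributiveLattice c ℓ} (F : Finite L) where
  open DistributiveLattice L
  open Order L
  open Count F
  open Finite F using (size)

  sα-cong : ∀ {α δ δ′} →
            (∀ {β} → β ≤ δ → InLα α β → β ≤ δ′) →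
            (∀ {β} → β ≤ δ′ → InLα α β → β ≤ δ) →
            sα α δ ≡ sα α δ′
  sα-cong δ⇒δ′ δ′⇒δ = cong length (filter-≐ _ _
    ( (λ (β≤δ , α≰β) → δ⇒δ′ β≤δ α≰β , α≰β)
    , (λ (β≤δ′ , α≰β) → δ′⇒δ β≤δ′ α≰β , α≰β) )
    (allFin size))

  sα≡s : ∀ {α δ} → (∀ {β} → β ≤ δ → InLα α β) → sα α δ ≡ s δ
  sα≡s ≤δ⇒InLα = cong length (filter-≐ _ _
    (proj₁ , λ β≤δ → β≤δ , ≤δ⇒InLα β≤δ)
    (allFin size))

lemma2p16 : ∀ {c ℓ} (L : DistributiveLattice c ℓ) (F : Finite L) →
    let open DistributiveLattice L
        open Order L
        open Count F
    in ∀ (α : Carrier) → IsMaximalJoinIrreducible α →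
       ∀ (δ : Carrier) → InXα α δ →
       ∀ (xδ : Carrier) → IsGreatestOfC α δ xδ →
       (sα α δ ≡ sα α xδ) × (sα α xδ ≡ s xδ)
lemma2p16 L F α (α-irr , _) δ _ xδ xδ-greatest =
    sα-cong F (≤-greatestOfC L α-irr xδ-greatest)
              (λ β≤xδ _ → ≤-trans L β≤xδ (InC⇒≤ L (proj₁ xδ-greatest)))
  , sα≡s F (InLα-downward L (proj₁ (proj₁ xδ-greatest)))
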